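{- Let $\mathbf{L}=\langle L,\leq\rangle$ be a complete lattice and $S$ an $L$-parameterization. An operator $C\colon L\to L$ is an $S$-closure operator in $\mathbf{L}$ if and only if $a\leq C(a)$ for all $a\in L$ and, for all $a,b\in L$ and all $\langle f,h\rangle\in S$, $a\leq h(C(b))$ implies $C(a)\leq h(C(b))$.
   Context: An isotone Galois connection in $\mathbf{L}$ is a pair $\langle f,h\rangle$ of maps $L\to L$ with $f(a)\leq b$ iff $a\leq h(b)$. An $L$-parameterization is a set $S$ of isotone Galois connections containing $\langle\mathrm{id},\mathrm{id}\rangle$. An $S$-closure operator is $C\colon L\to L$ with $a\leq C(a)$, $a\leq b$ implies $C(a)\leq C(b)$, and $C(h(C(a)))\leq h(C(a))$ for all $a,b\in L$ and $\langle f,h\rangle\in S$. -}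

module Defs where

open import Level using (Level; _⊔_) renaming (suc to lsuc)
open import Function using (id)
open import Data.Product using (_×_; _,_; Σ)
open import Relation.Unary using (Pred; _∈_)
open import Relation.Binary.Bundles using (Poset)

record CompleteLattice c ℓ₁ ℓ₂ ℓ : Set (lsuc (c ⊔ ℓ₁ ⊔ ℓ₂ ⊔ ℓ)) where
  field
    poset : Poset c ℓ₁ ℓ₂
  open Poset poset public
  field
    ⋁        : Pred Carrier ℓ → Carrier
    ⋁-upper  : (X : Pred Carrier ℓ) → ∀ x → x ∈ X → x ≤ ⋁ X
    ⋁-least  : (X : Pred Carrier ℓ) → ∀ y → (∀ x → x ∈ X → x ≤ y) → ⋁ X ≤ y

module _ {c ℓ₁ ℓ₂ ℓ : Level} (𝐋 : CompleteLattice c ℓ₁ ℓ₂ ℓ) where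
  open CompleteLattice 𝐋

  Maps² : Set c
  Maps² = (Carrier → Carrier) × (Carrier → Carrier)

  IsGaloisConnection : Maps² → Set (c ⊔ ℓ₂)
  IsGaloisConnection (f , h) =
    ∀ a b → (f a ≤ b → a ≤ h b) × (a ≤ h b → f a ≤ b)

  record IsParameterization {s : Level} (S : Pred Maps² s) : Set (c ⊔ ℓ₂ ⊔ s) where
    field
      galois  : ∀ p → p ∈ S → IsGaloisConnection p
      id∈S    : (id , id) ∈ S

  record IsSClosure {s : Level} (S : Pred Maps² s) (C : Carrier → Carrier)
         : Set (c ⊔ ℓ₂ ⊔ s) where
    field
      extensive : ∀ a → a ≤ C a
      monotone  : ∀ a b → a ≤ b → C a ≤ C b
      h-closed  : ∀ a f h → (f , h) ∈ S → C (h (C a)) ≤ h (C a)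

module Submission where

open import Defs
open import Level using (Level; _⊔_)
open import Function using (id)
open import Data.Product using (_×_; _,_)
open import Relation.Unary using (Pred; _∈_)
open import Function.Bundles using (_⇔_; mk⇔)

module _ {c ℓ₁ ℓ₂ ℓ s : Level} (𝐋 : CompleteLattice c ℓ₁ ℓ₂ ℓ) (S : Pred (Maps² 𝐋) s)
         (C : CompleteLattice.Carrier 𝐋 → CompleteLattice.Carrier 𝐋) where
  open CompleteLattice 𝐋

  ClosedBelow : Set (c ⊔ ℓ₂ ⊔ s)
  ClosedBelow = ∀ a b f h → (f , h) ∈ S → a ≤ h (C b) → C a ≤ h (C b)

  IsSClosure⇒closedBelow : IsSClosure 𝐋 S C → ClosedBelow
  IsSClosure⇒closedBelow cl a b f h fh∈S a≤hCb =
    trans (monotone a (h (C b)) a≤hCb) (h-closed b f h fh∈S)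
    where open IsSClosure cl

  -- Monotonicity is the instance ⟨id , id⟩ of the condition, applied to b ≤ C b;
  -- h-closedness is the instance a := h (C b).
  closedBelow⇒IsSClosure : (id , id) ∈ S → (∀ a → a ≤ C a) → ClosedBelow → IsSClosure 𝐋 S C
  closedBelow⇒IsSClosure id∈S extensive closed = record
    { extensive = extensive
    ; monotone  = λ a b a≤b → closed a b id id id∈S (trans a≤b (extensive b))
    ; h-closed  = λ a f h fh∈S → closed (h (C a)) a f h fh∈S refl
    }

theorem32 : {c ℓ₁ ℓ₂ ℓ s : Level} (𝐋 : CompleteLattice c ℓ₁ ℓ₂ ℓ)
    (S : Pred (Maps² 𝐋) s) → IsParameterization 𝐋 S →
    (C : CompleteLattice.Carrier 𝐋 → CompleteLattice.Carrier 𝐋) →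
    IsSClosure 𝐋 S C ⇔
    ((∀ a → CompleteLattice._≤_ 𝐋 a (C a))
    × (∀ a b f h → (f , h) ∈ S →
    CompleteLattice._≤_ 𝐋 a (h (C b)) → CompleteLattice._≤_ 𝐋 (C a) (h (C b))))
theorem32 𝐋 S param C = mk⇔
  (λ cl → IsSClosure.extensive cl , IsSClosure⇒closedBelow 𝐋 S C cl)
  (λ (extensive , closed) → closedBelow⇒IsSClosure 𝐋 S C id∈S extensive closed)
  where open IsParameterization param
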